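{- Let $G$ be a finite simple graph, let $I$ be a maximum critical independent set of $G$, and let $M$ be any maximum matching of $L_G$. Then \[ \mathrm{core}(G)\cap L(G)=M\bigl(N(I)-\mathrm{corona}(G)\bigr)\cup D(L_G). \]
   Context: All graphs are finite and simple. For $X\subseteq V(G)$, $N(X)=N_G(X)$ is the union of the neighborhoods of the vertices of $X$. $\Omega(G)$ is the family of maximum independent sets of $G$; $\mathrm{core}(G)=\bigcap\Omega(G)$ and $\mathrm{corona}(G)=\bigcup\Omega(G)$. An independent set $I$ of $G$ is critical if $|I|-|N(I)|\ge |J|-|N(J)|$ for every independent set $J$ of $G$; a maximum critical independent set is a critical independent set of maximum cardinality among critical independent sets. $L(G)$ denotes the set $J\cup N(J)$ for any maximum critical independent set $J$ of $G$ (this set does not depend on the choice of $J$), and $L_G=G[L(G)]$ is the induced subgraph. For a graph $H$, $D(H)$ is the set of vertices $v$ such that some maximum matching of $H$ does not cover $v$. For a matching $M$ and a vertex $v$, $M(v)=u$ if $uv\in M$ and $M(v)=v$ otherwise; for a set $S$, $M(S)=\{M(v):v\in S\}$. -}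

module Defs where

open import Data.Nat using (ℕ; _≤_; _+_)
open import Data.Bool using (Bool; true; false; _∧_; _∨_; not)
open import Data.Fin using (Fin; zero; suc; _≟_)
open import Data.Fin.Subset using (Subset; _∈_; _∪_; ∣_∣; inside; outside)
open import Data.Fin.Subset.Properties using (_∈?_)
open import Data.Vec using (tabulate)
open import Data.Product using (Σ; _×_; ∃)
open import Relation.Nullary using (¬_; does)
open import Relation.Binary.PropositionalEquality using (_≡_; _≢_)

record Graph : Set where
  field
    n      : ℕ
    adj    : Fin n → Fin n → Bool
    sym    : ∀ u v → adj u v ≡ adj v u
    irrefl : ∀ v → adj v v ≡ false
open Graph public

anyFin : ∀ {k} → (Fin k → Bool) → Bool
anyFin {ℕ.zero}  f = false
anyFin {ℕ.suc k} f = f zero ∨ anyFin (λ i → f (suc i))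

module _ (G : Graph) where

  Independent : Subset (n G) → Set
  Independent S = ∀ u v → u ∈ S → v ∈ S → adj G u v ≡ false

  N : Subset (n G) → Subset (n G)
  N S = tabulate (λ v → anyFin (λ u → does (u ∈? S) ∧ adj G u v))

  MaximumIndependent : Subset (n G) → Set
  MaximumIndependent S = Independent S × (∀ J → Independent J → ∣ J ∣ ≤ ∣ S ∣)

  InCore : Fin (n G) → Set
  InCore v = ∀ S → MaximumIndependent S → v ∈ S

  InCorona : Fin (n G) → Set
  InCorona v = ∃ λ S → MaximumIndependent S × v ∈ S

  -- |I| - |N(I)| ≥ |J| - |N(J)|, written without subtraction
  Critical : Subset (n G) → Set
  Critical I = Independent I ×
    (∀ J → Independent J → ∣ J ∣ + ∣ N I ∣ ≤ ∣ I ∣ + ∣ N J ∣)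

  MaximumCritical : Subset (n G) → Set
  MaximumCritical I = Critical I × (∀ J → Critical J → ∣ J ∣ ≤ ∣ I ∣)

  -- L(G) = J ∪ N(J) for the maximum critical independent set J
  L : Subset (n G) → Subset (n G)
  L J = J ∪ N J

  -- A matching of the induced subgraph G[X], given as its partner map
  -- v ↦ M(v)  (M(v) = v iff v is not covered).
  MatchingIn : Subset (n G) → (Fin (n G) → Fin (n G)) → Set
  MatchingIn X M = (∀ v → M (M v) ≡ v)
                 × (∀ v → M v ≢ v → adj G v (M v) ≡ true × v ∈ X × M v ∈ X)

  -- set of vertices covered by M (its size is twice the number of edges)
  covered : (Fin (n G) → Fin (n G)) → Subset (n G)
  covered M = tabulate (λ v → not (does (M v ≟ v)))

  MaximumMatchingIn : Subset (n G) → (Fin (n G) → Fin (n G)) → Set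
  MaximumMatchingIn X M = MatchingIn X M
    × (∀ M' → MatchingIn X M' → ∣ covered M' ∣ ≤ ∣ covered M ∣)

  InD : Subset (n G) → Fin (n G) → Set
  InD X v = v ∈ X × ∃ λ M → MaximumMatchingIn X M × M v ≡ v

-- Since I is critical, every S ⊆ N(I) has at least |S| neighbours in I (otherwise
-- J = I ─ N(S) would have |J| − |N(J)| > |I| − |N(I)|), so by Hall's theorem N(I)
-- can be matched into I. That matching of L_G covers 2|N(I)| vertices, so a maximum
-- matching M of L_G covers at least as many; as every vertex it covers outside N(I) lies
-- in I and is matched into N(I), counting forces M to match all of N(I) into I.
-- For a maximum independent set S, the set I ∪ (S ─ L(G)) is independent and M maps
-- N(I) ∩ S injectively into I ─ S; comparing sizes shows that I ∪ (S ─ L(G)) is again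
-- maximum and that M is a bijection from I ─ S onto N(I) ∩ S. So core(G) ∩ L(G) ⊆ I, and
-- a vertex v ∈ I misses the maximum independent set S only if M(v) ∈ N(I) ∩ S.

module Submission where

open import Defs hiding (sym)
open import Data.Bool using (Bool; true; false; not; _∧_)
open import Data.Bool.Properties using (∧-conicalˡ; ∧-conicalʳ; not-¬; ¬-not)
import Data.Bool as Bool
open import Data.Fin using (Fin; zero; suc; _≟_)
open import Data.Fin.Permutation using (permutation)
open import Data.Fin.Properties using (any?; all?)
open import Data.Fin.Subset
open import Data.Fin.Subset.Properties
open import Data.Nat using (ℕ; zero; suc; _+_; _≤_; _<_; _≤?_; _<?_; z≤n)
open import Data.Nat.Properties hiding (_≟_)
open import Algebra.Properties.CommutativeSemigroup +-commutativeSemigroup using (x∙yz≈y∙xz)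
import Algebra.Properties.CommutativeMonoid.Sum +-0-commutativeMonoid as Sum
open import Data.Product using (∃; _×_; _,_; proj₁; proj₂)
open import Data.Sum using (_⊎_; inj₁; inj₂)
open import Data.Vec using (_∷_; []; [_]; lookup; tabulate; here; there)
open import Data.Vec.Properties using (lookup∘tabulate; []=⇒lookup; lookup⇒[]=)
open import Function using (_∘_)
open import Function.Bundles using (_⇔_; mk⇔)
open import Relation.Nullary using (¬_; Dec; yes; no; does; contradiction)
open import Relation.Nullary.Decidable using (dec-true; dec-false; _×-dec_; _→-dec_)
open import Relation.Unary using (Decidable)
open import Relation.Binary.PropositionalEquality
  using (_≡_; _≢_; refl; sym; trans; cong; cong₂; subst; module ≡-Reasoning)

private
  variable
    k : ℕ
    p q r : Subset k
    x : Fin k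

Disjoint : Subset k → Subset k → Set
Disjoint p q = ∀ {x} → x ∈ p → x ∉ q

x∈p─q⁻ : ∀ (p q : Subset k) → x ∈ p ─ q → x ∈ p × x ∉ q
x∈p─q⁻ (inside ∷ p) (outside ∷ q) here = here , λ ()
x∈p─q⁻ {x = zero} (inside ∷ p) (inside ∷ q) ()
x∈p─q⁻ {x = zero} (outside ∷ p) (inside ∷ q) ()
x∈p─q⁻ {x = zero} (outside ∷ p) (outside ∷ q) ()
x∈p─q⁻ (s ∷ p) (t ∷ q) (there x∈p─q) with x∈p─q⁻ p q x∈p─q
... | x∈p , x∉q = there x∈p , x∉q ∘ drop-there

∣p∪q∣+∣p∩q∣≡∣p∣+∣q∣ : ∀ (p q : Subset k) → ∣ p ∪ q ∣ + ∣ p ∩ q ∣ ≡ ∣ p ∣ + ∣ q ∣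
∣p∪q∣+∣p∩q∣≡∣p∣+∣q∣ [] [] = refl
∣p∪q∣+∣p∩q∣≡∣p∣+∣q∣ (inside ∷ p) (inside ∷ q) = cong suc (trans (+-suc ∣ p ∪ q ∣ ∣ p ∩ q ∣)
  (trans (cong suc (∣p∪q∣+∣p∩q∣≡∣p∣+∣q∣ p q)) (sym (+-suc ∣ p ∣ ∣ q ∣))))
∣p∪q∣+∣p∩q∣≡∣p∣+∣q∣ (inside ∷ p) (outside ∷ q) = cong suc (∣p∪q∣+∣p∩q∣≡∣p∣+∣q∣ p q)
∣p∪q∣+∣p∩q∣≡∣p∣+∣q∣ (outside ∷ p) (inside ∷ q) =
  trans (cong suc (∣p∪q∣+∣p∩q∣≡∣p∣+∣q∣ p q)) (sym (+-suc ∣ p ∣ ∣ q ∣))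
∣p∪q∣+∣p∩q∣≡∣p∣+∣q∣ (outside ∷ p) (outside ∷ q) = ∣p∪q∣+∣p∩q∣≡∣p∣+∣q∣ p q

∣p∣≡∣p∩q∣+∣p─q∣ : ∀ (p q : Subset k) → ∣ p ∣ ≡ ∣ p ∩ q ∣ + ∣ p ─ q ∣
∣p∣≡∣p∩q∣+∣p─q∣ [] [] = refl
∣p∣≡∣p∩q∣+∣p─q∣ (inside ∷ p) (inside ∷ q) = cong suc (∣p∣≡∣p∩q∣+∣p─q∣ p q)
∣p∣≡∣p∩q∣+∣p─q∣ (inside ∷ p) (outside ∷ q) =
  trans (cong suc (∣p∣≡∣p∩q∣+∣p─q∣ p q)) (sym (+-suc ∣ p ∩ q ∣ ∣ p ─ q ∣))
∣p∣≡∣p∩q∣+∣p─q∣ (outside ∷ p) (inside ∷ q) = ∣p∣≡∣p∩q∣+∣p─q∣ p q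
∣p∣≡∣p∩q∣+∣p─q∣ (outside ∷ p) (outside ∷ q) = ∣p∣≡∣p∩q∣+∣p─q∣ p q

∣p∪q∣≤∣p∣+∣q∣ : ∀ (p q : Subset k) → ∣ p ∪ q ∣ ≤ ∣ p ∣ + ∣ q ∣
∣p∪q∣≤∣p∣+∣q∣ p q = ≤-trans (m≤m+n ∣ p ∪ q ∣ ∣ p ∩ q ∣) (≤-reflexive (∣p∪q∣+∣p∩q∣≡∣p∣+∣q∣ p q))

Empty⇒∣p∣≡0 : Empty p → ∣ p ∣ ≡ 0
Empty⇒∣p∣≡0 {k} empty = trans (cong ∣_∣ (Empty-unique empty)) (∣⊥∣≡0 k)

0<∣p∣⇒Nonempty : 0 < ∣ p ∣ → Nonempty p
0<∣p∣⇒Nonempty {p = p} 0<∣p∣ with nonempty? p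
... | yes ne = ne
... | no empty = contradiction (Empty⇒∣p∣≡0 empty) (>⇒≢ 0<∣p∣)

Disjoint⇒∣p∪q∣≡∣p∣+∣q∣ : Disjoint p q → ∣ p ∪ q ∣ ≡ ∣ p ∣ + ∣ q ∣
Disjoint⇒∣p∪q∣≡∣p∣+∣q∣ {p = p} {q} disjoint = begin
  ∣ p ∪ q ∣                 ≡⟨ +-identityʳ ∣ p ∪ q ∣ ⟨
  ∣ p ∪ q ∣ + 0             ≡⟨ cong (∣ p ∪ q ∣ +_) (Empty⇒∣p∣≡0 p∩q-empty) ⟨
  ∣ p ∪ q ∣ + ∣ p ∩ q ∣     ≡⟨ ∣p∪q∣+∣p∩q∣≡∣p∣+∣q∣ p q ⟩
  ∣ p ∣ + ∣ q ∣             ∎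
  where
  open ≡-Reasoning
  p∩q-empty : Empty (p ∩ q)
  p∩q-empty (x , x∈p∩q) = let x∈p , x∈q = x∈p∩q⁻ p q x∈p∩q in disjoint x∈p x∈q

p⊆q∧∣q∣≤∣p∣⇒q⊆p : p ⊆ q → ∣ q ∣ ≤ ∣ p ∣ → q ⊆ p
p⊆q∧∣q∣≤∣p∣⇒q⊆p {p = p} p⊆q ∣q∣≤∣p∣ {x} x∈q with x ∈? p
... | yes x∈p = x∈p
... | no x∉p = contradiction ∣q∣≤∣p∣ (<⇒≱ (p⊂q⇒∣p∣<∣q∣ (p⊆q , x , x∈q , x∉p)))

∈-tabulate⁺ : ∀ {f : Fin k → Bool} → f x ≡ true → x ∈ tabulate f
∈-tabulate⁺ {x = x} {f} fx = lookup⇒[]= x (tabulate f) (trans (lookup∘tabulate f x) fx)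

∈-tabulate⁻ : ∀ {f : Fin k → Bool} → x ∈ tabulate f → f x ≡ true
∈-tabulate⁻ {x = x} {f} x∈ = trans (sym (lookup∘tabulate f x)) ([]=⇒lookup x∈)

preimage : (Fin k → Fin k) → Subset k → Subset k
preimage σ p = tabulate (λ x → lookup p (σ x))

∈-preimage⁺ : ∀ {σ : Fin k → Fin k} → σ x ∈ p → x ∈ preimage σ p
∈-preimage⁺ σx∈p = ∈-tabulate⁺ ([]=⇒lookup σx∈p)

∈-preimage⁻ : ∀ {σ : Fin k → Fin k} → x ∈ preimage σ p → σ x ∈ p
∈-preimage⁻ {x = x} {p = p} {σ} x∈ = lookup⇒[]= (σ x) p (∈-tabulate⁻ x∈)

∣p∣≡∑ : ∀ (p : Subset k) → ∣ p ∣ ≡ Sum.sum (λ i → ∣ [ lookup p i ] ∣)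
∣p∣≡∑ [] = refl
∣p∣≡∑ (inside ∷ p) = cong suc (∣p∣≡∑ p)
∣p∣≡∑ (outside ∷ p) = ∣p∣≡∑ p

∣preimage∣≡∣p∣ : ∀ (σ : Fin k → Fin k) → (∀ x → σ (σ x) ≡ x) → ∀ p → ∣ preimage σ p ∣ ≡ ∣ p ∣
∣preimage∣≡∣p∣ σ σ-involutive p = begin
  ∣ preimage σ p ∣                                ≡⟨ ∣p∣≡∑ (preimage σ p) ⟩
  Sum.sum (λ i → ∣ [ lookup (preimage σ p) i ] ∣) ≡⟨ Sum.sum-cong-≗ lookup-preimage ⟩
  Sum.sum (λ i → ∣ [ lookup p (σ i) ] ∣)          ≡⟨ Sum.sum-permute _ σ-permutation ⟨
  Sum.sum (λ i → ∣ [ lookup p i ] ∣)              ≡⟨ ∣p∣≡∑ p ⟨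
  ∣ p ∣                                           ∎
  where
  open ≡-Reasoning
  lookup-preimage : ∀ i → ∣ [ lookup (preimage σ p) i ] ∣ ≡ ∣ [ lookup p (σ i) ] ∣
  lookup-preimage i = cong (∣_∣ ∘ [_]) (lookup∘tabulate (λ x → lookup p (σ x)) i)
  σ-permutation = permutation σ σ σ-involutive σ-involutive

x∈p⇒0<∣p∣ : x ∈ p → 0 < ∣ p ∣
x∈p⇒0<∣p∣ x∈p = ≤-<-trans z≤n (x∈p⇒∣p-x∣<∣p∣ x∈p)

p⊆q∪p─q : ∀ (p q : Subset k) → p ⊆ q ∪ (p ─ q)
p⊆q∪p─q p q {x} x∈p with x ∈? q
... | yes x∈q = x∈p∪q⁺ (inj₁ x∈q)
... | no x∉q = x∈p∪q⁺ (inj₂ (x∈p∧x∉q⇒x∈p─q x∈p x∉q))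

∪-least : p ⊆ r → q ⊆ r → p ∪ q ⊆ r
∪-least {p = p} {q = q} p⊆r q⊆r x∈p∪q with x∈p∪q⁻ p q x∈p∪q
... | inj₁ x∈p = p⊆r x∈p
... | inj₂ x∈q = q⊆r x∈q

anyFin⁺ : ∀ {f : Fin k → Bool} u → f u ≡ true → anyFin f ≡ true
anyFin⁺ zero fu rewrite fu = refl
anyFin⁺ {f = f} (suc u) fu with f zero
... | true = refl
... | false = anyFin⁺ u fu

anyFin⁻ : ∀ (f : Fin k → Bool) → anyFin f ≡ true → ∃ λ u → f u ≡ true
anyFin⁻ {ℕ.suc k} f any-f with f zero in f0
... | true = zero , f0
... | false with anyFin⁻ (λ i → f (suc i)) any-f
...   | u , fu = suc u , fu

does≡true⇒ : ∀ {A : Set} (a? : Dec A) → does a? ≡ true → A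
does≡true⇒ (yes a) _ = a

module _ (G : Graph) where

  adj-sym : ∀ {u v} → adj G u v ≡ true → adj G v u ≡ true
  adj-sym {u} {v} uv = trans (Graph.sym G v u) uv

  independent-nonadjacent : ∀ {S u v} → Independent G S → u ∈ S → v ∈ S → adj G u v ≢ true
  independent-nonadjacent independent u∈S v∈S = not-¬ (independent _ _ u∈S v∈S)

  independent-⊆ : ∀ {S T} → S ⊆ T → Independent G T → Independent G S
  independent-⊆ S⊆T independent u v u∈S v∈S = independent u v (S⊆T u∈S) (S⊆T v∈S)

  ∈N⁺ : ∀ {S u v} → u ∈ S → adj G u v ≡ true → v ∈ N G S
  ∈N⁺ {S} {u} u∈S uv = ∈-tabulate⁺ (anyFin⁺ u (cong₂ _∧_ (dec-true (u ∈? S) u∈S) uv))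

  ∈N⁻ : ∀ {S v} → v ∈ N G S → ∃ λ u → u ∈ S × adj G u v ≡ true
  ∈N⁻ {S} {v} v∈NS with anyFin⁻ _ (∈-tabulate⁻ v∈NS)
  ... | u , u∈S∧uv = u , does≡true⇒ (u ∈? S) (∧-conicalˡ _ _ u∈S∧uv) , ∧-conicalʳ _ _ u∈S∧uv

  ∉N⇒nonadjacent : ∀ {S u v} → u ∈ S → v ∉ N G S → adj G u v ≡ false
  ∉N⇒nonadjacent u∈S v∉NS = ¬-not (λ uv → v∉NS (∈N⁺ u∈S uv))

  ∈covered⁺ : ∀ (M : Fin (n G) → Fin (n G)) {v} → M v ≢ v → v ∈ covered G M
  ∈covered⁺ M {v} Mv≢v = ∈-tabulate⁺ (cong not (dec-false (M v ≟ v) Mv≢v))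

  ∈covered⁻ : ∀ (M : Fin (n G) → Fin (n G)) {v} → v ∈ covered G M → M v ≢ v
  ∈covered⁻ M {v} v∈ Mv≡v with trans (cong not (sym (dec-true (M v ≟ v) Mv≡v))) (∈-tabulate⁻ v∈)
  ... | ()

-- Hall's theorem

module _ (G : Graph) where

  private
    V = Subset (n G)

  N-mono : ∀ {S T : V} → S ⊆ T → N G S ⊆ N G T
  N-mono S⊆T v∈NS with ∈N⁻ G v∈NS
  ... | u , u∈S , uv = ∈N⁺ G (S⊆T u∈S) uv

  N-∪ : ∀ (S T : V) → N G (S ∪ T) ⊆ N G S ∪ N G T
  N-∪ S T v∈ with ∈N⁻ G v∈
  ... | u , u∈S∪T , uv with x∈p∪q⁻ S T u∈S∪T
  ...   | inj₁ u∈S = x∈p∪q⁺ (inj₁ (∈N⁺ G u∈S uv))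
  ...   | inj₂ u∈T = x∈p∪q⁺ (inj₂ (∈N⁺ G u∈T uv))

  HallCondition : V → V → Set
  HallCondition A B = ∀ S → S ⊆ A → ∣ S ∣ ≤ ∣ B ∩ N G S ∣

  record Saturating (A B : V) : Set where
    field
      partner           : Fin (n G) → Fin (n G)
      partner∈          : ∀ {x} → x ∈ A → partner x ∈ B
      partner-adj       : ∀ {x} → x ∈ A → adj G x (partner x) ≡ true
      partner-injective : ∀ {x y} → x ∈ A → y ∈ A → partner x ≡ partner y → x ≡ y

  saturating-Empty : ∀ {A B} → Empty A → Saturating A B
  saturating-Empty empty = record
    { partner           = λ x → x
    ; partner∈          = λ x∈A → contradiction (_ , x∈A) empty
    ; partner-adj       = λ x∈A → contradiction (_ , x∈A) empty
    ; partner-injective = λ x∈A _ _ → contradiction (_ , x∈A) empty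
    }

  saturating-⁅⁆ : ∀ {w b} → adj G w b ≡ true → Saturating ⁅ w ⁆ ⁅ b ⁆
  saturating-⁅⁆ {w} {b} wb = record
    { partner           = λ _ → b
    ; partner∈          = λ _ → x∈⁅x⁆ b
    ; partner-adj       = λ x∈⁅w⁆ → subst (λ x → adj G x b ≡ true) (sym (x∈⁅y⁆⇒x≡y w x∈⁅w⁆)) wb
    ; partner-injective = λ x∈⁅w⁆ y∈⁅w⁆ _ → trans (x∈⁅y⁆⇒x≡y w x∈⁅w⁆) (sym (x∈⁅y⁆⇒x≡y w y∈⁅w⁆))
    }

  saturating-mono : ∀ {A A′ B B′} → A′ ⊆ A → B ⊆ B′ → Saturating A B → Saturating A′ B′
  saturating-mono A′⊆A B⊆B′ f = record
    { partner           = partner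
    ; partner∈          = λ x∈A′ → B⊆B′ (partner∈ (A′⊆A x∈A′))
    ; partner-adj       = λ x∈A′ → partner-adj (A′⊆A x∈A′)
    ; partner-injective = λ x∈A′ y∈A′ → partner-injective (A′⊆A x∈A′) (A′⊆A y∈A′)
    }
    where open Saturating f

  saturating-∪ : ∀ {A₁ A₂ B₁ B₂} → Disjoint B₁ B₂ →
                 Saturating A₁ B₁ → Saturating A₂ B₂ → Saturating (A₁ ∪ A₂) (B₁ ∪ B₂)
  saturating-∪ {A₁} {A₂} {B₁} {B₂} disjoint f₁ f₂ = record
    { partner           = partner
    ; partner∈          = partner∈
    ; partner-adj       = partner-adj
    ; partner-injective = partner-injective
    }
    where
    module f₁ = Saturating f₁
    module f₂ = Saturating f₂

    ∈A₂ : ∀ {x} → x ∈ A₁ ∪ A₂ → x ∉ A₁ → x ∈ A₂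
    ∈A₂ x∈A x∉A₁ with x∈p∪q⁻ A₁ A₂ x∈A
    ... | inj₁ x∈A₁ = contradiction x∈A₁ x∉A₁
    ... | inj₂ x∈A₂ = x∈A₂

    partner : Fin (n G) → Fin (n G)
    partner x with x ∈? A₁
    ... | yes _ = f₁.partner x
    ... | no _  = f₂.partner x

    partner∈ : ∀ {x} → x ∈ A₁ ∪ A₂ → partner x ∈ B₁ ∪ B₂
    partner∈ {x} x∈A with x ∈? A₁
    ... | yes x∈A₁ = x∈p∪q⁺ (inj₁ (f₁.partner∈ x∈A₁))
    ... | no x∉A₁  = x∈p∪q⁺ (inj₂ (f₂.partner∈ (∈A₂ x∈A x∉A₁)))

    partner-adj : ∀ {x} → x ∈ A₁ ∪ A₂ → adj G x (partner x) ≡ true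
    partner-adj {x} x∈A with x ∈? A₁
    ... | yes x∈A₁ = f₁.partner-adj x∈A₁
    ... | no x∉A₁  = f₂.partner-adj (∈A₂ x∈A x∉A₁)

    partner-injective : ∀ {x y} → x ∈ A₁ ∪ A₂ → y ∈ A₁ ∪ A₂ → partner x ≡ partner y → x ≡ y
    partner-injective {x} {y} x∈A y∈A with x ∈? A₁ | y ∈? A₁
    ... | yes x∈A₁ | yes y∈A₁ = f₁.partner-injective x∈A₁ y∈A₁
    ... | no x∉A₁  | no y∉A₁  = f₂.partner-injective (∈A₂ x∈A x∉A₁) (∈A₂ y∈A y∉A₁)
    ... | yes x∈A₁ | no y∉A₁  = λ eq →
      contradiction (subst (_∈ B₂) (sym eq) (f₂.partner∈ (∈A₂ y∈A y∉A₁))) (disjoint (f₁.partner∈ x∈A₁))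
    ... | no x∉A₁  | yes y∈A₁ = λ eq →
      contradiction (subst (_∈ B₂) eq (f₂.partner∈ (∈A₂ x∈A x∉A₁))) (disjoint (f₁.partner∈ y∈A₁))

  Tight : V → V → V → Set
  Tight A B S = S ⊆ A × Nonempty S × ∣ S ∣ < ∣ A ∣ × ∣ B ∩ N G S ∣ ≤ ∣ S ∣

  tight? : ∀ A B S → Dec (Tight A B S)
  tight? A B S = S ⊆? A ×-dec nonempty? S ×-dec ∣ S ∣ <? ∣ A ∣ ×-dec ∣ B ∩ N G S ∣ ≤? ∣ S ∣

  hallCondition-restrict : ∀ {A B S} → HallCondition A B → S ⊆ A → HallCondition S (B ∩ N G S)
  hallCondition-restrict {A} {B} {S} hall S⊆A T T⊆S =
    ≤-trans (hall T (⊆-trans T⊆S S⊆A)) (p⊆q⇒∣p∣≤∣q∣ B∩NT⊆)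
    where
    B∩NT⊆ : B ∩ N G T ⊆ (B ∩ N G S) ∩ N G T
    B∩NT⊆ v∈ with x∈p∩q⁻ B (N G T) v∈
    ... | v∈B , v∈NT = x∈p∩q⁺ (x∈p∩q⁺ (v∈B , N-mono T⊆S v∈NT) , v∈NT)

  hallCondition-complement : ∀ {A B S} → HallCondition A B → S ⊆ A → ∣ B ∩ N G S ∣ ≤ ∣ S ∣ →
                             HallCondition (A ─ S) (B ─ N G S)
  hallCondition-complement {A} {B} {S} hall S⊆A tight T T⊆A─S = +-cancelʳ-≤ _ _ _ (begin
    ∣ T ∣ + ∣ S ∣                  ≡⟨ Disjoint⇒∣p∪q∣≡∣p∣+∣q∣ (λ x∈T → proj₂ (x∈p─q⁻ A S (T⊆A─S x∈T))) ⟨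
    ∣ T ∪ S ∣                      ≤⟨ hall (T ∪ S) (∪-least (⊆-trans T⊆A─S (p─q⊆p A S)) S⊆A) ⟩
    ∣ B ∩ N G (T ∪ S) ∣            ≤⟨ p⊆q⇒∣p∣≤∣q∣ B∩N⊆ ⟩
    ∣ B′ ∪ (B ∩ N G S) ∣           ≤⟨ ∣p∪q∣≤∣p∣+∣q∣ B′ (B ∩ N G S) ⟩
    ∣ B′ ∣ + ∣ B ∩ N G S ∣         ≤⟨ +-monoʳ-≤ ∣ B′ ∣ tight ⟩
    ∣ B′ ∣ + ∣ S ∣                 ∎)
    where
    open ≤-Reasoning
    B′ = (B ─ N G S) ∩ N G T
    B∩N⊆ : B ∩ N G (T ∪ S) ⊆ B′ ∪ (B ∩ N G S)
    B∩N⊆ {v} v∈ with x∈p∩q⁻ B (N G (T ∪ S)) v∈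
    ... | v∈B , v∈N with v ∈? N G S
    ...   | yes v∈NS = x∈p∪q⁺ (inj₂ (x∈p∩q⁺ (v∈B , v∈NS)))
    ...   | no v∉NS with x∈p∪q⁻ (N G T) (N G S) (N-∪ T S v∈N)
    ...     | inj₁ v∈NT = x∈p∪q⁺ (inj₁ (x∈p∩q⁺ (x∈p∧x∉q⇒x∈p─q v∈B v∉NS , v∈NT)))
    ...     | inj₂ v∈NS = contradiction v∈NS v∉NS

  hallCondition-remove : ∀ {A B w b} → (∀ T → ¬ Tight A B T) → w ∈ A → HallCondition (A - w) (B - b)
  hallCondition-remove {A} {B} {w} {b} loose w∈A T T⊆A-w with nonempty? T
  ... | no empty = ≤-trans (≤-reflexive (Empty⇒∣p∣≡0 empty)) z≤n
  ... | yes nonempty = ≤-pred (begin-strict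
    ∣ T ∣               <⟨ ∣T∣<∣B∩NT∣ ⟩
    ∣ B ∩ N G T ∣       ≤⟨ p⊆q⇒∣p∣≤∣q∣ B∩NT⊆ ⟩
    ∣ B′ ∪ ⁅ b ⁆ ∣      ≤⟨ ∣p∪q∣≤∣p∣+∣q∣ B′ ⁅ b ⁆ ⟩
    ∣ B′ ∣ + ∣ ⁅ b ⁆ ∣  ≡⟨ cong (∣ B′ ∣ +_) (∣⁅x⁆∣≡1 b) ⟩
    ∣ B′ ∣ + 1          ≡⟨ +-comm ∣ B′ ∣ 1 ⟩
    suc ∣ B′ ∣          ∎)
    where
    open ≤-Reasoning
    B′ = (B - b) ∩ N G T
    T⊆A = ⊆-trans T⊆A-w (p─q⊆p A ⁅ w ⁆)
    ∣T∣<∣A∣ = ≤-<-trans (p⊆q⇒∣p∣≤∣q∣ T⊆A-w) (x∈p⇒∣p-x∣<∣p∣ w∈A)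
    ∣T∣<∣B∩NT∣ = ≰⇒> (λ ∣B∩NT∣≤∣T∣ → loose T (T⊆A , nonempty , ∣T∣<∣A∣ , ∣B∩NT∣≤∣T∣))
    B∩NT⊆ : B ∩ N G T ⊆ B′ ∪ ⁅ b ⁆
    B∩NT⊆ {v} v∈ with v ≟ b | x∈p∩q⁻ B (N G T) v∈
    ... | yes refl | _          = x∈p∪q⁺ (inj₂ (x∈⁅x⁆ v))
    ... | no v≢b   | v∈B , v∈NT = x∈p∪q⁺ (inj₁ (x∈p∩q⁺ (x∈p∧x≢y⇒x∈p-y v∈B v≢b , v∈NT)))

  hallCondition⇒neighbour : ∀ {A B w} → HallCondition A B → w ∈ A → ∃ λ b → b ∈ B × adj G w b ≡ true
  hallCondition⇒neighbour {A} {B} {w} hall w∈A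
    with 0<∣p∣⇒Nonempty (<-≤-trans (x∈p⇒0<∣p∣ (x∈⁅x⁆ w)) (hall ⁅ w ⁆ ⁅w⁆⊆A))
    where
    ⁅w⁆⊆A : ⁅ w ⁆ ⊆ A
    ⁅w⁆⊆A x∈⁅w⁆ = subst (_∈ A) (sym (x∈⁅y⁆⇒x≡y w x∈⁅w⁆)) w∈A
  ... | b , b∈B∩N with x∈p∩q⁻ B (N G ⁅ w ⁆) b∈B∩N
  ...   | b∈B , b∈N with ∈N⁻ G b∈N
  ...     | u , u∈⁅w⁆ , ub = b , b∈B , subst (λ x → adj G x b ≡ true) (x∈⁅y⁆⇒x≡y w u∈⁅w⁆) ub

  HallUpTo : ℕ → Set
  HallUpTo m = ∀ {A B} → ∣ A ∣ ≤ m → HallCondition A B → Saturating A B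

  hall-tight : ∀ {m A B S} → HallUpTo m → ∣ A ∣ ≤ suc m → HallCondition A B → Tight A B S →
               Saturating A B
  hall-tight {A = A} {B} {S} ih ∣A∣≤1+m hall (S⊆A , (w , w∈S) , ∣S∣<∣A∣ , tight) =
    saturating-mono (p⊆q∪p─q A S) (∪-least (p∩q⊆p B (N G S)) (p─q⊆p B (N G S)))
      (saturating-∪ disjoint
        (ih {B = B ∩ N G S} (≤-pred (≤-trans ∣S∣<∣A∣ ∣A∣≤1+m)) (hallCondition-restrict {B = B} hall S⊆A))
        (ih {B = B ─ N G S} (≤-pred (≤-trans ∣A─S∣<∣A∣ ∣A∣≤1+m))
            (hallCondition-complement {B = B} hall S⊆A tight)))
    where
    ∣A─S∣<∣A∣ = p∩q≢∅⇒∣p─q∣<∣p∣ A S (w , x∈p∩q⁺ (S⊆A w∈S , w∈S))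
    disjoint : Disjoint (B ∩ N G S) (B ─ N G S)
    disjoint x∈B∩NS x∈B─NS = proj₂ (x∈p─q⁻ B (N G S) x∈B─NS) (proj₂ (x∈p∩q⁻ B (N G S) x∈B∩NS))

  hall-loose : ∀ {m A B w} → HallUpTo m → ∣ A ∣ ≤ suc m → HallCondition A B →
               (∀ T → ¬ Tight A B T) → w ∈ A → Saturating A B
  hall-loose {A = A} {B} {w} ih ∣A∣≤1+m hall loose w∈A with hallCondition⇒neighbour hall w∈A
  ... | b , b∈B , wb =
    saturating-mono (p⊆q∪p─q A ⁅ w ⁆) (∪-least ⁅b⁆⊆B (p─q⊆p B ⁅ b ⁆))
      (saturating-∪ disjoint (saturating-⁅⁆ wb)
        (ih {B = B - b} (≤-pred (≤-trans (x∈p⇒∣p-x∣<∣p∣ w∈A) ∣A∣≤1+m))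
            (hallCondition-remove {B = B} loose w∈A)))
    where
    ⁅b⁆⊆B : ⁅ b ⁆ ⊆ B
    ⁅b⁆⊆B x∈⁅b⁆ = subst (_∈ B) (sym (x∈⁅y⁆⇒x≡y b x∈⁅b⁆)) b∈B
    disjoint : Disjoint ⁅ b ⁆ (B - b)
    disjoint x∈⁅b⁆ x∈B-b = proj₂ (x∈p─q⁻ B ⁅ b ⁆ x∈B-b) x∈⁅b⁆

  -- Induction on ∣ A ∣: split A along a tight set if there is one; otherwise every proper
  -- nonempty subset has a surplus of neighbours, so any edge w b may be used and removed.
  hall-upTo : ∀ m → HallUpTo m
  hall-upTo zero ∣A∣≤0 _ = saturating-Empty (λ (x , x∈A) → <⇒≱ (x∈p⇒0<∣p∣ x∈A) ∣A∣≤0)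
  hall-upTo (suc m) {A} {B} ∣A∣≤1+m hall with anySubset? (tight? A B)
  ... | yes (S , tight) = hall-tight (hall-upTo m) ∣A∣≤1+m hall tight
  ... | no no-tight with nonempty? A
  ...   | yes (w , w∈A) = hall-loose (hall-upTo m) ∣A∣≤1+m hall (λ T tight → no-tight (T , tight)) w∈A
  ...   | no empty = saturating-Empty empty

  hallCondition⇒saturating : ∀ {A B} → HallCondition A B → Saturating A B
  hallCondition⇒saturating {A} = hall-upTo ∣ A ∣ ≤-refl

-- Matchings

module _ (G : Graph) where

  private
    V = Subset (n G)

  module FromSaturating {A B : V} (disjoint : Disjoint A B) (f : Saturating G A B) where

    open Saturating f

    match : Fin (n G) → Fin (n G)
    match v with v ∈? A
    ... | yes _ = partner v
    ... | no _ with any? (λ x → x ∈? A ×-dec partner x ≟ v)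
    ...   | yes (x , _) = x
    ...   | no _        = v

    data View (v : Fin (n G)) : Fin (n G) → Set where
      source    : v ∈ A → View v (partner v)
      target    : ∀ {x} → x ∈ A → partner x ≡ v → View v x
      unmatched : (∀ {x} → x ∈ A → partner x ≢ v) → View v v

    view : ∀ v → View v (match v)
    view v with v ∈? A
    ... | yes v∈A = source v∈A
    ... | no _ with any? (λ x → x ∈? A ×-dec partner x ≟ v)
    ...   | yes (x , x∈A , px≡v) = target x∈A px≡v
    ...   | no no-preimage       = unmatched (λ x∈A px≡v → no-preimage (_ , x∈A , px≡v))

    match-source : ∀ {x} → x ∈ A → match x ≡ partner x
    match-source {x} x∈A with x ∈? A
    ... | yes _   = refl
    ... | no x∉A = contradiction x∈A x∉A

    match-target : ∀ {x} → x ∈ A → match (partner x) ≡ x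
    match-target {x} x∈A with match (partner x) | view (partner x)
    ... | _ | source px∈A          = contradiction (partner∈ x∈A) (disjoint px∈A)
    ... | _ | target y∈A py≡px     = partner-injective y∈A x∈A py≡px
    ... | _ | unmatched no-preimage = contradiction refl (no-preimage x∈A)

    match-involutive : ∀ v → match (match v) ≡ v
    match-involutive v with match v in m≡ | view v
    ... | _ | source v∈A     = match-target v∈A
    ... | _ | target x∈A px≡v = trans (match-source x∈A) px≡v
    ... | _ | unmatched _     = m≡

    match-matching : MatchingIn G (A ∪ B) match
    match-matching = match-involutive , matched
      where
      matched : ∀ v → match v ≢ v → adj G v (match v) ≡ true × v ∈ A ∪ B × match v ∈ A ∪ B
      matched v m≢v with match v | view v
      ... | _ | source v∈A =
        partner-adj v∈A , x∈p∪q⁺ (inj₁ v∈A) , x∈p∪q⁺ (inj₂ (partner∈ v∈A))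
      ... | _ | target {x} x∈A px≡v =
          adj-sym G (subst (λ w → adj G x w ≡ true) px≡v (partner-adj x∈A))
        , x∈p∪q⁺ (inj₂ (subst (_∈ B) px≡v (partner∈ x∈A)))
        , x∈p∪q⁺ (inj₁ x∈A)
      ... | _ | unmatched _ = contradiction refl m≢v

  saturating⇒matching : ∀ {A B} → Disjoint A B → Saturating G A B →
                        ∃ λ M → MatchingIn G (A ∪ B) M × (∀ {x} → x ∈ A → M x ∈ B)
  saturating⇒matching disjoint f =
    match , match-matching , λ x∈A → subst (_∈ _) (sym (match-source x∈A)) (Saturating.partner∈ f x∈A)
    where open FromSaturating disjoint f

  involution-covers : ∀ {M A} → (∀ v → M (M v) ≡ v) → (∀ {x} → x ∈ A → M x ∉ A) →
                      ∣ A ∣ + ∣ A ∣ ≤ ∣ covered G M ∣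
  involution-covers {M} {A} involutive leaves = begin
    ∣ A ∣ + ∣ A ∣                 ≡⟨ cong (∣ A ∣ +_) (∣preimage∣≡∣p∣ M involutive A) ⟨
    ∣ A ∣ + ∣ preimage M A ∣      ≡⟨ Disjoint⇒∣p∪q∣≡∣p∣+∣q∣ A-disjoint-M⁻¹A ⟨
    ∣ A ∪ preimage M A ∣          ≤⟨ p⊆q⇒∣p∣≤∣q∣ (∪-least A⊆covered M⁻¹A⊆covered) ⟩
    ∣ covered G M ∣               ∎
    where
    open ≤-Reasoning
    A-disjoint-M⁻¹A : Disjoint A (preimage M A)
    A-disjoint-M⁻¹A x∈A x∈M⁻¹A = leaves x∈A (∈-preimage⁻ x∈M⁻¹A)
    A⊆covered : A ⊆ covered G M
    A⊆covered x∈A = ∈covered⁺ G M (λ Mx≡x → leaves x∈A (subst (_∈ A) (sym Mx≡x) x∈A))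
    M⁻¹A⊆covered : preimage M A ⊆ covered G M
    M⁻¹A⊆covered x∈M⁻¹A = ∈covered⁺ G M (λ Mx≡x →
      leaves (subst (_∈ A) Mx≡x (∈-preimage⁻ x∈M⁻¹A)) (∈-preimage⁻ x∈M⁻¹A))

maximum-exists : ∀ {k} {P : Subset k → Set} → Decidable P → ∀ {p} → P p →
                 ∃ λ q → P q × ∀ r → P r → ∣ r ∣ ≤ ∣ q ∣
maximum-exists {k} {P} P? {p} Pp = search k p Pp (m≤n+m k ∣ p ∣)
  where
  search : ∀ m p → P p → k ≤ ∣ p ∣ + m → ∃ λ q → P q × ∀ r → P r → ∣ r ∣ ≤ ∣ q ∣
  search zero p Pp k≤∣p∣+0 =
    p , Pp , λ r _ → ≤-trans (∣p∣≤n r) (≤-trans k≤∣p∣+0 (≤-reflexive (+-identityʳ ∣ p ∣)))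
  search (suc m) p Pp k≤ with anySubset? (λ r → P? r ×-dec ∣ p ∣ <? ∣ r ∣)
  ... | yes (r , Pr , ∣p∣<∣r∣) =
    search m r Pr (≤-trans k≤ (≤-trans (≤-reflexive (+-suc ∣ p ∣ m)) (+-monoˡ-≤ m ∣p∣<∣r∣)))
  ... | no no-larger = p , Pp , λ r Pr → ≮⇒≥ (λ ∣p∣<∣r∣ → no-larger (r , Pr , ∣p∣<∣r∣))

independent? : ∀ (G : Graph) → Decidable (Independent G)
independent? G S = all? λ u → all? λ v → u ∈? S →-dec (v ∈? S →-dec adj G u v Bool.≟ false)

maximumIndependent-exists : ∀ (G : Graph) → ∃ (MaximumIndependent G)
maximumIndependent-exists G = maximum-exists (independent? G) {⊥} (λ _ _ u∈⊥ _ → contradiction u∈⊥ ∉⊥)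

-- Critical independent sets

module CriticalSet (G : Graph) (I : Subset (n G)) (critical : Critical G I) where

  private
    independent : Independent G I
    independent = proj₁ critical

  I-disjoint-N : Disjoint I (N G I)
  I-disjoint-N u∈I u∈NI with ∈N⁻ G u∈NI
  ... | w , w∈I , wu = independent-nonadjacent G independent w∈I u∈I wu

  ∈L⁻ : ∀ {v} → v ∈ L G I → v ∉ N G I → v ∈ I
  ∈L⁻ v∈L v∉N with x∈p∪q⁻ I (N G I) v∈L
  ... | inj₁ v∈I = v∈I
  ... | inj₂ v∈N = contradiction v∈N v∉N

  hallCondition-N : HallCondition G (N G I) I
  hallCondition-N S S⊆N = +-cancelʳ-≤ _ _ _ (begin
    ∣ S ∣ + (∣ J ∣ + ∣ N G I ─ S ∣)          ≡⟨ x∙yz≈y∙xz (∣ S ∣) (∣ J ∣) (∣ N G I ─ S ∣) ⟩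
    ∣ J ∣ + (∣ S ∣ + ∣ N G I ─ S ∣)          ≤⟨ +-monoʳ-≤ ∣ J ∣ ∣S∣+∣N─S∣≤∣N∣ ⟩
    ∣ J ∣ + ∣ N G I ∣                        ≤⟨ proj₂ critical J J-independent ⟩
    ∣ I ∣ + ∣ N G J ∣                        ≤⟨ +-monoʳ-≤ ∣ I ∣ (p⊆q⇒∣p∣≤∣q∣ NJ⊆N─S) ⟩
    ∣ I ∣ + ∣ N G I ─ S ∣                    ≡⟨ cong (_+ ∣ N G I ─ S ∣) (∣p∣≡∣p∩q∣+∣p─q∣ I (N G S)) ⟩
    ∣ I ∩ N G S ∣ + ∣ J ∣ + ∣ N G I ─ S ∣    ≡⟨ +-assoc (∣ I ∩ N G S ∣) (∣ J ∣) (∣ N G I ─ S ∣) ⟩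
    ∣ I ∩ N G S ∣ + (∣ J ∣ + ∣ N G I ─ S ∣)  ∎)
    where
    open ≤-Reasoning
    J = I ─ N G S
    J-independent = independent-⊆ G (p─q⊆p I (N G S)) independent
    ∣S∣+∣N─S∣≤∣N∣ : ∣ S ∣ + ∣ N G I ─ S ∣ ≤ ∣ N G I ∣
    ∣S∣+∣N─S∣≤∣N∣ = ≤-trans (+-monoˡ-≤ _ (p⊆q⇒∣p∣≤∣q∣ (λ x∈S → x∈p∩q⁺ (S⊆N x∈S , x∈S))))
                            (≤-reflexive (sym (∣p∣≡∣p∩q∣+∣p─q∣ (N G I) S)))
    NJ⊆N─S : N G J ⊆ N G I ─ S
    NJ⊆N─S v∈NJ with ∈N⁻ G v∈NJ
    ... | u , u∈J , uv with x∈p─q⁻ I (N G S) u∈J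
    ...   | u∈I , u∉NS = x∈p∧x∉q⇒x∈p─q (∈N⁺ G u∈I uv) (λ v∈S → u∉NS (∈N⁺ G v∈S (adj-sym G uv)))

  matching-N-into-I : ∃ λ M → MatchingIn G (L G I) M × (∀ {x} → x ∈ N G I → M x ∈ I)
  matching-N-into-I with saturating⇒matching G (λ x∈N x∈I → I-disjoint-N x∈I x∈N)
                                              (hallCondition⇒saturating G hallCondition-N)
  ... | M , matching , N⇒I = M , subst (λ X → MatchingIn G X M) (∪-comm (N G I) I) matching , N⇒I

  module MaximumMatching {M} (maximum : MaximumMatchingIn G (L G I) M) where

    involutive : ∀ v → M (M v) ≡ v
    involutive = proj₁ (proj₁ maximum)

    matched : ∀ v → M v ≢ v → adj G v (M v) ≡ true × v ∈ L G I × M v ∈ L G I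
    matched = proj₂ (proj₁ maximum)

    partner-of-I∈N : ∀ {v} → v ∈ I → M v ≢ v → M v ∈ N G I
    partner-of-I∈N {v} v∈I Mv≢v with matched v Mv≢v
    ... | v~Mv , _ , Mv∈L with x∈p∪q⁻ I (N G I) Mv∈L
    ...   | inj₁ Mv∈I = contradiction v~Mv (independent-nonadjacent G independent v∈I Mv∈I)
    ...   | inj₂ Mv∈N = Mv∈N

    C = covered G M

    covered⊆L : C ⊆ L G I
    covered⊆L {v} v∈C = proj₁ (proj₂ (matched v (∈covered⁻ G M v∈C)))

    C─N⊆M⁻¹N : C ─ N G I ⊆ preimage M (N G I)
    C─N⊆M⁻¹N {v} v∈C─N with x∈p─q⁻ C (N G I) v∈C─N
    ... | v∈C , v∉N = ∈-preimage⁺ (partner-of-I∈N (∈L⁻ (covered⊆L v∈C) v∉N) (∈covered⁻ G M v∈C))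

    ∣N∣≤∣C─N∣ : ∣ N G I ∣ ≤ ∣ C ─ N G I ∣
    ∣N∣≤∣C─N∣ with matching-N-into-I
    ... | M₀ , matching₀ , N⇒I₀ = +-cancelˡ-≤ ∣ N G I ∣ _ _ (begin
      ∣ N G I ∣ + ∣ N G I ∣            ≤⟨ involution-covers G (proj₁ matching₀) M₀-leaves-N ⟩
      ∣ covered G M₀ ∣                 ≤⟨ proj₂ maximum M₀ matching₀ ⟩
      ∣ C ∣                            ≡⟨ ∣p∣≡∣p∩q∣+∣p─q∣ C (N G I) ⟩
      ∣ C ∩ N G I ∣ + ∣ C ─ N G I ∣    ≤⟨ +-monoˡ-≤ _ (∣p∩q∣≤∣q∣ C (N G I)) ⟩
      ∣ N G I ∣ + ∣ C ─ N G I ∣        ∎)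
      where
      open ≤-Reasoning
      M₀-leaves-N : ∀ {x} → x ∈ N G I → M₀ x ∉ N G I
      M₀-leaves-N x∈N = I-disjoint-N (N⇒I₀ x∈N)

    M⁻¹N⊆C─N : preimage M (N G I) ⊆ C ─ N G I
    M⁻¹N⊆C─N = p⊆q∧∣q∣≤∣p∣⇒q⊆p C─N⊆M⁻¹N
      (≤-trans (≤-reflexive (∣preimage∣≡∣p∣ M involutive (N G I))) ∣N∣≤∣C─N∣)

    partner-of-N∈I : ∀ {v} → v ∈ N G I → M v ∈ I
    partner-of-N∈I {v} v∈N = ∈L⁻ (covered⊆L Mv∈C) Mv∉N
      where
      MMv∈N : M (M v) ∈ N G I
      MMv∈N = subst (_∈ N G I) (sym (involutive v)) v∈N
      Mv∈C─N : M v ∈ C ─ N G I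
      Mv∈C─N = M⁻¹N⊆C─N (∈-preimage⁺ MMv∈N)
      Mv∈C = proj₁ (x∈p─q⁻ C (N G I) Mv∈C─N)
      Mv∉N = proj₂ (x∈p─q⁻ C (N G I) Mv∈C─N)

  module Exchange {M} (matching : MatchingIn G (L G I) M) (N⇒I : ∀ {v} → v ∈ N G I → M v ∈ I)
                  {S} (maximumS : MaximumIndependent G S) where

    S′ : Subset (n G)
    S′ = I ∪ (S ─ L G I)

    S─L-disjoint-N : Disjoint (S ─ L G I) (N G I)
    S─L-disjoint-N x∈S─L x∈N = proj₂ (x∈p─q⁻ S (L G I) x∈S─L) (q⊆p∪q I (N G I) x∈N)

    S′-independent : Independent G S′
    S′-independent u v u∈S′ v∈S′ with x∈p∪q⁻ I (S ─ L G I) u∈S′ | x∈p∪q⁻ I (S ─ L G I) v∈S′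
    ... | inj₁ u∈I   | inj₁ v∈I   = independent u v u∈I v∈I
    ... | inj₁ u∈I   | inj₂ v∈S─L = ∉N⇒nonadjacent G u∈I (S─L-disjoint-N v∈S─L)
    ... | inj₂ u∈S─L | inj₁ v∈I   = trans (Graph.sym G u v) (∉N⇒nonadjacent G v∈I (S─L-disjoint-N u∈S─L))
    ... | inj₂ u∈S─L | inj₂ v∈S─L = proj₁ maximumS u v (p─q⊆p S (L G I) u∈S─L) (p─q⊆p S (L G I) v∈S─L)

    N∩S⊆M⁻¹[I─S] : N G I ∩ S ⊆ preimage M (I ─ S)
    N∩S⊆M⁻¹[I─S] {v} v∈N∩S = ∈-preimage⁺ (x∈p∧x∉q⇒x∈p─q Mv∈I Mv∉S)
      where
      v∈N = proj₁ (x∈p∩q⁻ (N G I) S v∈N∩S)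
      Mv∈I = N⇒I v∈N
      Mv≢v : M v ≢ v
      Mv≢v Mv≡v = I-disjoint-N (subst (_∈ I) Mv≡v Mv∈I) v∈N
      Mv∉S : M v ∉ S
      Mv∉S Mv∈S = independent-nonadjacent G (proj₁ maximumS) (proj₂ (x∈p∩q⁻ (N G I) S v∈N∩S)) Mv∈S
                    (proj₁ (proj₂ matching v Mv≢v))

    ∣S∣≤∣I∩S∣+∣N∩S∣+∣S─L∣ : ∣ S ∣ ≤ ∣ I ∩ S ∣ + ∣ N G I ∩ S ∣ + ∣ S ─ L G I ∣
    ∣S∣≤∣I∩S∣+∣N∩S∣+∣S─L∣ = begin
      ∣ S ∣                                        ≡⟨ ∣p∣≡∣p∩q∣+∣p─q∣ S (L G I) ⟩
      ∣ S ∩ L G I ∣ + ∣ S ─ L G I ∣                ≤⟨ +-monoˡ-≤ _ (p⊆q⇒∣p∣≤∣q∣ S∩L⊆) ⟩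
      ∣ I ∩ S ∪ N G I ∩ S ∣ + ∣ S ─ L G I ∣        ≤⟨ +-monoˡ-≤ _ (∣p∪q∣≤∣p∣+∣q∣ (I ∩ S) (N G I ∩ S)) ⟩
      ∣ I ∩ S ∣ + ∣ N G I ∩ S ∣ + ∣ S ─ L G I ∣    ∎
      where
      open ≤-Reasoning
      S∩L⊆ : S ∩ L G I ⊆ I ∩ S ∪ N G I ∩ S
      S∩L⊆ v∈S∩L with x∈p∩q⁻ S (L G I) v∈S∩L
      ... | v∈S , v∈L with x∈p∪q⁻ I (N G I) v∈L
      ...   | inj₁ v∈I = x∈p∪q⁺ (inj₁ (x∈p∩q⁺ (v∈I , v∈S)))
      ...   | inj₂ v∈N = x∈p∪q⁺ (inj₂ (x∈p∩q⁺ (v∈N , v∈S)))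

    ∣S′∣≡∣I∩S∣+∣I─S∣+∣S─L∣ : ∣ S′ ∣ ≡ ∣ I ∩ S ∣ + ∣ I ─ S ∣ + ∣ S ─ L G I ∣
    ∣S′∣≡∣I∩S∣+∣I─S∣+∣S─L∣ =
      trans (Disjoint⇒∣p∪q∣≡∣p∣+∣q∣ I-disjoint-S─L) (cong (_+ ∣ S ─ L G I ∣) (∣p∣≡∣p∩q∣+∣p─q∣ I S))
      where
      I-disjoint-S─L : Disjoint I (S ─ L G I)
      I-disjoint-S─L x∈I x∈S─L = proj₂ (x∈p─q⁻ S (L G I) x∈S─L) (p⊆p∪q (N G I) x∈I)

    ∣N∩S∣≤∣I─S∣ : ∣ N G I ∩ S ∣ ≤ ∣ I ─ S ∣
    ∣N∩S∣≤∣I─S∣ =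
      ≤-trans (p⊆q⇒∣p∣≤∣q∣ N∩S⊆M⁻¹[I─S]) (≤-reflexive (∣preimage∣≡∣p∣ M (proj₁ matching) (I ─ S)))

    S′-maximum : MaximumIndependent G S′
    S′-maximum = S′-independent , λ J J-independent → ≤-trans (proj₂ maximumS J J-independent) (begin
      ∣ S ∣                                        ≤⟨ ∣S∣≤∣I∩S∣+∣N∩S∣+∣S─L∣ ⟩
      ∣ I ∩ S ∣ + ∣ N G I ∩ S ∣ + ∣ S ─ L G I ∣    ≤⟨ +-monoˡ-≤ _ (+-monoʳ-≤ ∣ I ∩ S ∣ ∣N∩S∣≤∣I─S∣) ⟩
      ∣ I ∩ S ∣ + ∣ I ─ S ∣ + ∣ S ─ L G I ∣        ≡⟨ ∣S′∣≡∣I∩S∣+∣I─S∣+∣S─L∣ ⟨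
      ∣ S′ ∣                                       ∎)
      where open ≤-Reasoning

    ∣I─S∣≤∣N∩S∣ : ∣ I ─ S ∣ ≤ ∣ N G I ∩ S ∣
    ∣I─S∣≤∣N∩S∣ = +-cancelˡ-≤ ∣ I ∩ S ∣ _ _ (+-cancelʳ-≤ ∣ S ─ L G I ∣ _ _ (begin
      ∣ I ∩ S ∣ + ∣ I ─ S ∣ + ∣ S ─ L G I ∣        ≡⟨ ∣S′∣≡∣I∩S∣+∣I─S∣+∣S─L∣ ⟨
      ∣ S′ ∣                                       ≤⟨ proj₂ maximumS S′ S′-independent ⟩
      ∣ S ∣                                        ≤⟨ ∣S∣≤∣I∩S∣+∣N∩S∣+∣S─L∣ ⟩
      ∣ I ∩ S ∣ + ∣ N G I ∩ S ∣ + ∣ S ─ L G I ∣    ∎))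
      where open ≤-Reasoning

    ∉S⇒partner∈N∩S : ∀ {v} → v ∈ I → v ∉ S → M v ∈ N G I ∩ S
    ∉S⇒partner∈N∩S {v} v∈I v∉S =
      M⁻¹[I─S]⊆N∩S (∈-preimage⁺ (subst (_∈ I ─ S) (sym (proj₁ matching v)) (x∈p∧x∉q⇒x∈p─q v∈I v∉S)))
      where
      M⁻¹[I─S]⊆N∩S : preimage M (I ─ S) ⊆ N G I ∩ S
      M⁻¹[I─S]⊆N∩S = p⊆q∧∣q∣≤∣p∣⇒q⊆p N∩S⊆M⁻¹[I─S]
        (≤-trans (≤-reflexive (∣preimage∣≡∣p∣ M (proj₁ matching) (I ─ S))) ∣I─S∣≤∣N∩S∣)

  core∩L⊆I : ∀ {v} → InCore G v → v ∈ L G I → v ∈ I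
  core∩L⊆I {v} core v∈L with matching-N-into-I | maximumIndependent-exists G
  ... | M₀ , matching₀ , N⇒I₀ | S , maximumS
    with x∈p∪q⁻ I (S ─ L G I) (core _ (Exchange.S′-maximum matching₀ N⇒I₀ maximumS))
  ...   | inj₁ v∈I   = v∈I
  ...   | inj₂ v∈S─L = contradiction v∈L (proj₂ (x∈p─q⁻ S (L G I) v∈S─L))

  inCore⁺ : ∀ {M v} → MaximumMatchingIn G (L G I) M → v ∈ I →
            (∀ {S} → MaximumIndependent G S → M v ∉ N G I ∩ S) → InCore G v
  inCore⁺ {v = v} maximum v∈I excluded S maximumS with v ∈? S
  ... | yes v∈S = v∈S
  ... | no v∉S  = contradiction (∉S⇒partner∈N∩S v∈I v∉S) (excluded maximumS)
    where open Exchange (proj₁ maximum) (MaximumMatching.partner-of-N∈I maximum) maximumS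

mainTheorem1 : (G : Graph) (I : Subset (n G)) → MaximumCritical G I →
    (M : Fin (n G) → Fin (n G)) → MaximumMatchingIn G (L G I) M →
    ∀ v → (InCore G v × v ∈ L G I)
          ⇔ ((∃ λ u → (u ∈ N G I × ¬ InCorona G u) × M u ≡ v) ⊎ InD G (L G I) v)
mainTheorem1 G I (critical , _) M maximum v = mk⇔ to from
  where
  open CriticalSet G I critical
  open MaximumMatching maximum

  to : InCore G v × v ∈ L G I → (∃ λ u → (u ∈ N G I × ¬ InCorona G u) × M u ≡ v) ⊎ InD G (L G I) v
  to (core , v∈L) with M v ≟ v
  ... | yes Mv≡v = inj₂ (v∈L , M , maximum , Mv≡v)
  ... | no Mv≢v  = inj₁ (M v , (partner-of-I∈N (core∩L⊆I core v∈L) Mv≢v , outside-corona) , involutive v)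
    where
    outside-corona : ¬ InCorona G (M v)
    outside-corona (S , maximumS , Mv∈S) =
      independent-nonadjacent G (proj₁ maximumS) (core S maximumS) Mv∈S (proj₁ (matched v Mv≢v))

  from : (∃ λ u → (u ∈ N G I × ¬ InCorona G u) × M u ≡ v) ⊎ InD G (L G I) v → InCore G v × v ∈ L G I
  from (inj₁ (u , (u∈N , u∉corona) , Mu≡v)) =
    inCore⁺ maximum v∈I (λ {S} maximumS Mv∈N∩S →
      u∉corona (S , maximumS , subst (_∈ S) Mv≡u (proj₂ (x∈p∩q⁻ (N G I) S Mv∈N∩S)))) ,
    p⊆p∪q (N G I) v∈I
    where
    v∈I = subst (_∈ I) Mu≡v (partner-of-N∈I u∈N)
    Mv≡u = trans (cong M (sym Mu≡v)) (involutive u)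
  from (inj₂ (v∈L , M′ , maximum′ , M′v≡v)) =
    inCore⁺ maximum′ v∈I (λ {S} _ M′v∈N∩S →
      I-disjoint-N v∈I (subst (_∈ N G I) M′v≡v (proj₁ (x∈p∩q⁻ (N G I) S M′v∈N∩S)))) ,
    v∈L
    where
    module M′ = MaximumMatching maximum′
    v∈I = ∈L⁻ v∈L (λ v∈N → I-disjoint-N (subst (_∈ I) M′v≡v (M′.partner-of-N∈I v∈N)) v∈N)
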